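{- Let $\mathbb{S}$ be a finite set of students and $\mathbb{H}$ a finite set of schools with $|\mathbb{S}| = |\mathbb{H}| = n$, each school having exactly one seat. Let $r : \mathbb{S}\times\mathbb{H}\to\{1,2,\dots\}$ be a rank function (ties allowed), where $r(s,h)$ is the rank at which student $s$ prefers school $h$ (smaller is better), and assume preferences are symmetric: school $h$ ranks student $s$ at rank $r(h,s) = r(s,h)$. Let $w:\mathbb{S}\times\mathbb{H}\to\mathbb{R}_{\ge 0}$ be a weight function such that for all $s,s'\in\mathbb{S}$ and $h,h'\in\mathbb{H}$, $$ r(s,h) < r(s,h') \ \text{and}\ r(s,h) < r(s',h) \implies w(s,h) > w(s',h) + w(s,h'). $$ Let $M^*$ be a perfect matching between $\mathbb{S}$ and $\mathbb{H}$ maximizing $\sum_{(s,h)\in M^*} w(s,h)$ over all perfect matchings. Then $M^*$ is a weakly stable matching.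
   Context: A perfect matching $M$ is weakly stable if it has no blocking pair, where a blocking pair is a pair $(s,h)\notin M$ such that $s$ strictly prefers $h$ to its partner $M(s)$ and $h$ strictly prefers $s$ to its partner $M(h)$; with symmetric preferences this means $r(s,h) < r(s,M(s))$ and $r(s,h) < r(M(h),h)$. Pairs that are only equally preferred are not blocking.
   Formalization: The weight function w takes values in the nonnegative rationals instead of the nonnegative reals. -}

module Defs where

open import Data.Nat using (ℕ; zero; suc; _<_)
open import Data.Fin using (Fin; zero; suc)
open import Data.Fin.Permutation using (Permutation′; _⟨$⟩ʳ_; _⟨$⟩ˡ_)
open import Data.Rational using (ℚ; 0ℚ; _+_)
open import Data.Product using (_×_; ∃₂)
open import Relation.Binary.PropositionalEquality using (_≡_)
open import Relation.Nullary using (¬_)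

-- Students and schools are both indexed by Fin n.
-- A perfect matching is a bijection from students to schools:
-- student s is matched with school M ⟨$⟩ʳ s; school h with student M ⟨$⟩ˡ h.
Matching : ℕ → Set
Matching n = Permutation′ n

sumFin : ∀ {n} → (Fin n → ℚ) → ℚ
sumFin {zero}  f = 0ℚ
sumFin {suc n} f = f zero + sumFin (λ i → f (suc i))

totalWeight : ∀ {n} → (Fin n → Fin n → ℚ) → Matching n → ℚ
totalWeight w M = sumFin (λ s → w s (M ⟨$⟩ʳ s))

-- Blocking pair (s,h) for M with symmetric ranks r (r s h = rank of h for s
-- = rank of s for h): (s,h) ∉ M, s strictly prefers h to M(s),
-- h strictly prefers s to M(h).
BlockingPair : ∀ {n} → (Fin n → Fin n → ℕ) → Matching n → Fin n → Fin n → Set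
BlockingPair r M s h =
  ¬ (M ⟨$⟩ʳ s ≡ h) × r s h < r s (M ⟨$⟩ʳ s) × r s h < r (M ⟨$⟩ˡ h) h

WeaklyStable : ∀ {n} → (Fin n → Fin n → ℕ) → Matching n → Set
WeaklyStable r M = ∀ s h → ¬ BlockingPair r M s h

{-# OPTIONS --safe #-}
-- If (s, h) blocked M, with h′ = M(s) and s′ = M⁻¹(h), then giving h to s and
-- h′ to s′ changes the total weight by w(s,h) + w(s′,h′) − w(s,h′) − w(s′,h),
-- which is positive by the weight condition (applied to s, s′, h, h′) and
-- nonnegativity of w(s′,h′); this contradicts the maximality of M.
module Submission where

open import Defs
open import Data.Nat using (ℕ; zero; suc; _<_; _≥_)
open import Data.Fin using (Fin; zero; suc; _≟_)
open import Data.Fin.Properties using (punchInᵢ≢i)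
open import Data.Fin.Permutation using (_⟨$⟩ʳ_; _⟨$⟩ˡ_; _∘ₚ_; transpose; inverseʳ)
import Data.Fin.Permutation.Components as PC
open import Data.Rational using (ℚ; 0ℚ; _+_; _≤_; _≰_) renaming (_<_ to _<ℚ_)
import Data.Rational.Properties as ℚ
open import Data.Vec.Functional using (removeAt; updateAt)
open import Data.Vec.Functional.Properties using (updateAt-updates; updateAt-minimal)
open import Algebra.Bundles using (CommutativeMonoid)
import Algebra.Properties.CommutativeMonoid.Sum as CommutativeMonoidSum
open import Algebra.Properties.CommutativeSemigroup
  (CommutativeMonoid.commutativeSemigroup ℚ.+-0-commutativeMonoid)
  using (x∙yz≈y∙xz)
open import Data.Product using (_,_)
open import Function using (_∘_; const)
open import Relation.Binary.PropositionalEquality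
  using (_≡_; _≢_; refl; sym; trans; cong; cong₂; module ≡-Reasoning)
open import Relation.Nullary using (yes; no)
open import Relation.Nullary.Decidable using (dec-true; dec-false)

open CommutativeMonoidSum ℚ.+-0-commutativeMonoid using (sum; sum-remove; sum-cong-≗)

private
  variable
    n : ℕ

transposeᵢ≡j : (i j : Fin n) → PC.transpose i j i ≡ j
transposeᵢ≡j i j rewrite dec-true (i ≟ i) refl = refl

transposeⱼ≡i : (i j : Fin n) → PC.transpose i j j ≡ i
transposeⱼ≡i i j with j ≟ i
... | yes refl = refl
... | no _ rewrite dec-true (j ≟ j) refl = refl

transposeₖ≡k : {i j k : Fin n} → k ≢ i → k ≢ j → PC.transpose i j k ≡ k
transposeₖ≡k {i = i} {j} {k} k≢i k≢j
  rewrite dec-false (k ≟ i) k≢i | dec-false (k ≟ j) k≢j = refl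

sumFin≡sum : (f : Fin n → ℚ) → sumFin f ≡ sum f
sumFin≡sum {n = zero}  f = refl
sumFin≡sum {n = suc n} f = cong (f zero +_) (sumFin≡sum (f ∘ suc))

sum-exchange : (f g : Fin n → ℚ) (a : Fin n) → (∀ i → i ≢ a → f i ≡ g i) →
               g a + sum f ≡ f a + sum g
sum-exchange {n = suc n} f g a f≗g-off-a = begin
  g a + sum f                        ≡⟨ cong (g a +_) (sum-remove f) ⟩
  g a + (f a + sum (removeAt f a))   ≡⟨ cong (λ x → g a + (f a + x)) (sum-cong-≗ f≗g-off-punchIn) ⟩
  g a + (f a + sum (removeAt g a))   ≡⟨ x∙yz≈y∙xz (g a) (f a) _ ⟩
  f a + (g a + sum (removeAt g a))   ≡⟨ cong (f a +_) (sum-remove g) ⟨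
  f a + sum g                        ∎
  where
  open ≡-Reasoning
  f≗g-off-punchIn : ∀ j → removeAt f a j ≡ removeAt g a j
  f≗g-off-punchIn j = f≗g-off-a _ (punchInᵢ≢i a j)

sum-exchange₂ : (f g : Fin n → ℚ) {a b : Fin n} → a ≢ b →
                (∀ i → i ≢ a → i ≢ b → f i ≡ g i) →
                (g a + g b) + sum f ≡ (f a + f b) + sum g
sum-exchange₂ f g {a} {b} a≢b f≗g-off-ab = begin
  (g a + g b) + sum f   ≡⟨ cong (_+ sum f) (ℚ.+-comm (g a) (g b)) ⟩
  (g b + g a) + sum f   ≡⟨ ℚ.+-assoc (g b) (g a) (sum f) ⟩
  g b + (g a + sum f)   ≡⟨ cong (λ x → g b + (x + sum f)) k-at-a ⟨
  g b + (k a + sum f)   ≡⟨ cong (g b +_) (sum-exchange f k a f≗k-off-a) ⟩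
  g b + (f a + sum k)   ≡⟨ x∙yz≈y∙xz (g b) (f a) (sum k) ⟩
  f a + (g b + sum k)   ≡⟨ cong (f a +_) (sum-exchange k g b k≗g-off-b) ⟩
  f a + (k b + sum g)   ≡⟨ cong (λ x → f a + (x + sum g)) k-at-b ⟩
  f a + (f b + sum g)   ≡⟨ ℚ.+-assoc (f a) (f b) (sum g) ⟨
  (f a + f b) + sum g   ∎
  where
  open ≡-Reasoning
  k : Fin _ → ℚ
  k = updateAt f a (const (g a))
  k-at-a : k a ≡ g a
  k-at-a = updateAt-updates a f
  k-at-b : k b ≡ f b
  k-at-b = updateAt-minimal b a f (a≢b ∘ sym)
  f≗k-off-a : ∀ i → i ≢ a → f i ≡ k i
  f≗k-off-a i i≢a = sym (updateAt-minimal i a f i≢a)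
  k≗g-off-b : ∀ i → i ≢ b → k i ≡ g i
  k≗g-off-b i i≢b with i ≟ a
  ... | yes refl = k-at-a
  ... | no i≢a   = trans (updateAt-minimal i a f i≢a) (f≗g-off-ab i i≢a i≢b)

swapPartners : Matching n → Fin n → Fin n → Matching n
swapPartners M s s′ = transpose s s′ ∘ₚ M

module _ (w : Fin n → Fin n → ℚ) (M : Matching n) {s s′ : Fin n} where

  private
    M′ = swapPartners M s s′

  totalWeight-swapPartners : s ≢ s′ →
    (w s′ (M ⟨$⟩ʳ s′) + w s (M ⟨$⟩ʳ s)) + totalWeight w M′ ≡
    (w s′ (M ⟨$⟩ʳ s) + w s (M ⟨$⟩ʳ s′)) + totalWeight w M
  totalWeight-swapPartners s≢s′ = begin
    (wM s′ + wM s) + totalWeight w M′    ≡⟨ cong (wM s′ + wM s +_) (sumFin≡sum wM′) ⟩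
    (wM s′ + wM s) + sum wM′             ≡⟨ sum-exchange₂ wM′ wM (s≢s′ ∘ sym) wM′≗wM-off-ss′ ⟩
    (wM′ s′ + wM′ s) + sum wM            ≡⟨ cong₂ (λ x y → (x + y) + sum wM) wM′-at-s′ wM′-at-s ⟩
    new + sum wM                         ≡⟨ cong (new +_) (sumFin≡sum wM) ⟨
    new + totalWeight w M                ∎
    where
    open ≡-Reasoning
    wM wM′ : Fin _ → ℚ
    wM  i = w i (M ⟨$⟩ʳ i)
    wM′ i = w i (M′ ⟨$⟩ʳ i)
    new = w s′ (M ⟨$⟩ʳ s) + w s (M ⟨$⟩ʳ s′)
    wM′-at-s′ : wM′ s′ ≡ w s′ (M ⟨$⟩ʳ s)
    wM′-at-s′ = cong (λ j → w s′ (M ⟨$⟩ʳ j)) (transposeⱼ≡i s s′)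
    wM′-at-s : wM′ s ≡ w s (M ⟨$⟩ʳ s′)
    wM′-at-s = cong (λ j → w s (M ⟨$⟩ʳ j)) (transposeᵢ≡j s s′)
    wM′≗wM-off-ss′ : ∀ i → i ≢ s′ → i ≢ s → wM′ i ≡ wM i
    wM′≗wM-off-ss′ i i≢s′ i≢s = cong (λ j → w i (M ⟨$⟩ʳ j)) (transposeₖ≡k i≢s i≢s′)

  swapPartners-improves : s ≢ s′ → 0ℚ ≤ w s′ (M ⟨$⟩ʳ s) →
    w s′ (M ⟨$⟩ʳ s′) + w s (M ⟨$⟩ʳ s) <ℚ w s (M ⟨$⟩ʳ s′) →
    totalWeight w M′ ≰ totalWeight w M
  swapPartners-improves s≢s′ 0≤w gain W′≤W = ℚ.<-irrefl refl (begin-strict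
    old + W′                    ≤⟨ ℚ.+-monoʳ-≤ old W′≤W ⟩
    old + W                     <⟨ ℚ.+-monoˡ-< W gain ⟩
    w s (M ⟨$⟩ʳ s′) + W         ≡⟨ cong (_+ W) (ℚ.+-identityˡ (w s (M ⟨$⟩ʳ s′))) ⟨
    (0ℚ + w s (M ⟨$⟩ʳ s′)) + W  ≤⟨ ℚ.+-monoˡ-≤ W (ℚ.+-monoˡ-≤ (w s (M ⟨$⟩ʳ s′)) 0≤w) ⟩
    new + W                     ≡⟨ totalWeight-swapPartners s≢s′ ⟨
    old + W′                    ∎)
    where
    open ℚ.≤-Reasoning
    old = w s′ (M ⟨$⟩ʳ s′) + w s (M ⟨$⟩ʳ s)
    new = w s′ (M ⟨$⟩ʳ s) + w s (M ⟨$⟩ʳ s′)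
    W = totalWeight w M
    W′ = totalWeight w M′

theorem1 : (n : ℕ) (r : Fin n → Fin n → ℕ) (w : Fin n → Fin n → ℚ) →
    (∀ s h → r s h ≥ 1) →
    (∀ s h → 0ℚ ≤ w s h) →
    (∀ s s′ h h′ → r s h < r s h′ → r s h < r s′ h →
      w s′ h + w s h′ <ℚ w s h) →
    (M : Matching n) →
    (∀ (M′ : Matching n) → totalWeight w M′ ≤ totalWeight w M) →
    WeaklyStable r M
theorem1 n r w _ w≥0 dominance M optimal s h (M[s]≢h , s-prefers-h , h-prefers-s) =
  swapPartners-improves w M s≢s′ (w≥0 s′ (M ⟨$⟩ʳ s)) gain (optimal (swapPartners M s s′))
  where
  s′ = M ⟨$⟩ˡ h
  M[s′]≡h : M ⟨$⟩ʳ s′ ≡ h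
  M[s′]≡h = inverseʳ M
  s≢s′ : s ≢ s′
  s≢s′ s≡s′ = M[s]≢h (trans (cong (M ⟨$⟩ʳ_) s≡s′) M[s′]≡h)
  gain : w s′ (M ⟨$⟩ʳ s′) + w s (M ⟨$⟩ʳ s) <ℚ w s (M ⟨$⟩ʳ s′)
  gain rewrite M[s′]≡h = dominance s s′ h (M ⟨$⟩ʳ s) s-prefers-h h-prefers-s
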